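{- Let $p$ be a prime and let $L$ be an integral $\mathbb{Z}_p$-lattice with an orthogonal splitting $L\cong M\perp K$ into nonzero sublattices $M$ and $K$. If at least one of $M$ and $K$ is $\mathbb{Z}_p$-universal, then $L$ is primitively $\mathbb{Z}_p$-universal.
   Context: A $\mathbb{Z}_p$-lattice $L$ is a finitely generated $\mathbb{Z}_p$-submodule of a nondegenerate quadratic space over $\mathbb{Q}_p$ with quadratic map $q$; it is integral if $q(L)\subseteq\mathbb{Z}_p$. A vector $v\in L$ is primitive if $\{\alpha\in\mathbb{Q}_p:\alpha v\in L\}=\mathbb{Z}_p$. A lattice $N$ is $\mathbb{Z}_p$-universal if $q(N)=\mathbb{Z}_p$; $L$ is primitively $\mathbb{Z}_p$-universal if every nonzero $\alpha\in\mathbb{Z}_p$ equals $q(v)$ for some primitive $v\in L$. -}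

module Defs where

open import Data.Nat as ℕ using (ℕ; zero; suc; _^_)
open import Data.Integer as ℤ using (ℤ; +_; -_; _-_)
  renaming (_+_ to _+ℤ_; _*_ to _*ℤ_)
import Data.Integer.Properties as ℤP
open import Algebra.Properties.CommutativeSemigroup ℤP.+-commutativeSemigroup using (interchange)
open import Data.Fin using (Fin; zero; suc; splitAt)
open import Data.Sum using (_⊎_; inj₁; inj₂)
open import Data.Product using (Σ; ∃; _×_; _,_)
open import Relation.Nullary using (¬_)
import Relation.Binary.PropositionalEquality
open import Relation.Binary.PropositionalEquality
  using (_≡_; refl; cong; cong₂; trans; sym)

_∣ℤ_ : ℤ → ℤ → Set
a ∣ℤ b = ∃ λ (t : ℤ) → b ≡ t *ℤ a

private
  open Relation.Binary.PropositionalEquality.≡-Reasoning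

  ∣-+ : ∀ {a b c} → a ∣ℤ b → a ∣ℤ c → a ∣ℤ (b +ℤ c)
  ∣-+ {a} (s , refl) (t , refl) =
    s +ℤ t , sym (ℤP.*-distribʳ-+ a s t)

  ∣-*ˡ : ∀ {a b} c → a ∣ℤ b → a ∣ℤ (c *ℤ b)
  ∣-*ˡ {a} c (s , refl) =
    c *ℤ s , sym (ℤP.*-assoc c s a)

  ∣-*ʳ : ∀ {a b} c → a ∣ℤ b → a ∣ℤ (b *ℤ c)
  ∣-*ʳ {a} c (s , refl) =
    s *ℤ c , trans (ℤP.*-assoc s a c) (trans (cong (s *ℤ_) (ℤP.*-comm a c)) (sym (ℤP.*-assoc s c a)))

  ∣-neg : ∀ {a b} → a ∣ℤ b → a ∣ℤ (- b)
  ∣-neg {a} (s , refl) =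
    - s , ℤP.neg-distribˡ-* s a

  ∣-resp : ∀ {a b c} → b ≡ c → a ∣ℤ b → a ∣ℤ c
  ∣-resp refl d = d

  ∣-0 : ∀ a → a ∣ℤ (+ 0)
  ∣-0 a = + 0 , refl

-- The p-adic integers ℤ_p, realised as the inverse limit lim ℤ/p^n ℤ:
-- a p-adic integer is a sequence (x_n) of integers with
-- x_{n+1} ≡ x_n (mod p^n); two such sequences are equal in ℤ_p iff
-- x_n ≡ y_n (mod p^n) for all n.  (Equality is a setoid equality _≈_.)

record ℤp (p : ℕ) : Set where
  constructor mkℤp
  field
    seq : ℕ → ℤ
    coh : ∀ n → (+ (p ^ n)) ∣ℤ (seq (suc n) - seq n)
open ℤp public

module _ {p : ℕ} where

  infix  4 _≈_
  infixl 6 _+p_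
  infixl 7 _*p_

  _≈_ : ℤp p → ℤp p → Set
  x ≈ y = ∀ n → (+ (p ^ n)) ∣ℤ (seq x n - seq y n)

  0p : ℤp p
  0p = mkℤp (λ _ → + 0) (λ n → ∣-0 _)

  1p : ℤp p
  1p = mkℤp (λ _ → + 1) (λ n → ∣-resp {+ (p ^ n)} refl (+ 0 , refl))

  pp : ℤp p
  pp = mkℤp (λ _ → + p) (λ n → ∣-resp {+ (p ^ n)} (sym (ℤP.i≡j⇒i-j≡0 {+ p} refl)) (∣-0 _))

  _+p_ : ℤp p → ℤp p → ℤp p
  x +p y = mkℤp (λ n → seq x n +ℤ seq y n) λ n →
    ∣-resp (eq (seq x (suc n)) (seq x n) (seq y (suc n)) (seq y n))
           (∣-+ (coh x n) (coh y n))
    where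
    eq : ∀ a b c d → (a - b) +ℤ (c - d) ≡ (a +ℤ c) - (b +ℤ d)
    eq a b c d = trans (interchange a (- b) c (- d))
                       (cong ((a +ℤ c) +ℤ_) (sym (ℤP.neg-distrib-+ b d)))

  -p_ : ℤp p → ℤp p
  -p x = mkℤp (λ n → - seq x n) λ n →
    ∣-resp (eq (seq x (suc n)) (seq x n)) (∣-neg (coh x n))
    where
    eq : ∀ a b → - (a - b) ≡ (- a) - (- b)
    eq a b = ℤP.neg-distrib-+ a (- b)

  _*p_ : ℤp p → ℤp p → ℤp p
  x *p y = mkℤp (λ n → seq x n *ℤ seq y n) λ n →
    ∣-resp (eq (seq x (suc n)) (seq x n) (seq y (suc n)) (seq y n))
           (∣-+ (∣-*ˡ (seq x (suc n)) (coh y n)) (∣-*ʳ (seq y n) (coh x n)))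
    where
    open Relation.Binary.PropositionalEquality.≡-Reasoning
    eq : ∀ a b c d → a *ℤ (c - d) +ℤ (a - b) *ℤ d ≡ a *ℤ c - b *ℤ d
    eq a b c d = begin
      a *ℤ (c - d) +ℤ (a - b) *ℤ d
        ≡⟨ cong₂ _+ℤ_ (ℤP.*-distribˡ-+ a c (- d)) (ℤP.*-distribʳ-+ d a (- b)) ⟩
      (a *ℤ c +ℤ a *ℤ (- d)) +ℤ (a *ℤ d +ℤ (- b) *ℤ d)
        ≡⟨ cong₂ (λ u v → (a *ℤ c +ℤ u) +ℤ (a *ℤ d +ℤ v))
                 (sym (ℤP.neg-distribʳ-* a d)) (sym (ℤP.neg-distribˡ-* b d)) ⟩
      (a *ℤ c +ℤ - (a *ℤ d)) +ℤ (a *ℤ d +ℤ - (b *ℤ d))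
        ≡⟨ ℤP.+-assoc (a *ℤ c) (- (a *ℤ d)) (a *ℤ d +ℤ - (b *ℤ d)) ⟩
      a *ℤ c +ℤ (- (a *ℤ d) +ℤ (a *ℤ d +ℤ - (b *ℤ d)))
        ≡⟨ cong (a *ℤ c +ℤ_) (sym (ℤP.+-assoc (- (a *ℤ d)) (a *ℤ d) (- (b *ℤ d)))) ⟩
      a *ℤ c +ℤ ((- (a *ℤ d) +ℤ a *ℤ d) +ℤ - (b *ℤ d))
        ≡⟨ cong (λ u → a *ℤ c +ℤ (u +ℤ - (b *ℤ d))) (ℤP.+-inverseˡ (a *ℤ d)) ⟩
      a *ℤ c +ℤ (+ 0 +ℤ - (b *ℤ d))
        ≡⟨ cong (a *ℤ c +ℤ_) (ℤP.+-identityˡ (- (b *ℤ d))) ⟩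
      a *ℤ c - b *ℤ d ∎

Vecp : ℕ → ℕ → Set
Vecp p n = Fin n → ℤp p

sump : ∀ {p} n → (Fin n → ℤp p) → ℤp p
sump zero    f = 0p
sump (suc n) f = f zero +p sump n (λ i → f (suc i))

_≈v_ : ∀ {p n} → Vecp p n → Vecp p n → Set
x ≈v y = ∀ i → x i ≈ y i

_·_ : ∀ {p n' n} → (Fin n' → Fin n → ℤp p) → Vecp p n → Vecp p n'
_·_ {n = n} A x i = sump n (λ j → A i j *p x j)

-- A (finitely generated, torsion-free, hence free) ℤ_p-lattice L with
-- basis e_1..e_n and integral quadratic map q is recorded by its rank
-- and coefficients c i j ∈ ℤ_p with  q(Σ x_i e_i) = Σ_{i,j} c_ij x_i x_j.
-- (Every integral quadratic map on ℤ_p^n has this form, and every such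
-- form lives in some nondegenerate ambient quadratic space over ℚ_p.)

record Lattice (p : ℕ) : Set where
  constructor lattice
  field
    rank  : ℕ
    coeff : Fin rank → Fin rank → ℤp p
open Lattice public

Q : ∀ {p} (L : Lattice p) → Vecp p (rank L) → ℤp p
Q L x = sump (rank L) λ i → sump (rank L) λ j → coeff L i j *p (x i *p x j)

_⊥_ : ∀ {p} → Lattice p → Lattice p → Lattice p
M ⊥ K = lattice (rank M ℕ.+ rank K) c
  where
  c : Fin (rank M ℕ.+ rank K) → Fin (rank M ℕ.+ rank K) → ℤp _
  c i j with splitAt (rank M) i | splitAt (rank M) j
  ... | inj₁ a | inj₁ b = coeff M a b
  ... | inj₂ a | inj₂ b = coeff K a b
  ... | _      | _      = 0p

Isometry : ∀ {p} (L N : Lattice p) → Set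
Isometry {p} L N =
  Σ (Fin (rank N) → Fin (rank L) → ℤp p) λ A →
  Σ (Fin (rank L) → Fin (rank N) → ℤp p) λ B →
    (∀ (x : Vecp p (rank L)) → (B · (A · x)) ≈v x) ×
    (∀ (y : Vecp p (rank N)) → (A · (B · y)) ≈v y) ×
    (∀ (x : Vecp p (rank L)) → Q N (A · x) ≈ Q L x)

-- v ∈ L is primitive: {α ∈ ℚ_p : α v ∈ L} = ℤ_p, i.e. v ∉ pL.
Primitive : ∀ {p} (L : Lattice p) → Vecp p (rank L) → Set
Primitive {p} L v = ¬ (Σ (Vecp p (rank L)) λ w → v ≈v (λ i → pp *p w i))

-- N is ℤ_p-universal: q(N) = ℤ_p  (q(N) ⊆ ℤ_p holds by integrality).
Universal : ∀ {p} (N : Lattice p) → Set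
Universal {p} N = ∀ (α : ℤp p) → Σ (Vecp p (rank N)) λ x → Q N x ≈ α

PrimitivelyUniversal : ∀ {p} (L : Lattice p) → Set
PrimitivelyUniversal {p} L =
  ∀ (α : ℤp p) → ¬ (α ≈ 0p) →
    Σ (Vecp p (rank L)) λ v → Primitive L v × Q L v ≈ α

{-# OPTIONS --safe #-}
-- Say M is universal (the other case is symmetric) and write 1 for the
-- all-ones vector of K ≠ 0; it is primitive because 1 ∉ pℤ_p. Choosing
-- x ∈ M with q(x) = α − q(1), the vector x + 1 ∈ M ⊥ K has
-- q(x + 1) = q(x) + q(1) = α and is primitive since its K-component is.
-- The isometry L ≅ M ⊥ K carries it to a primitive vector of L.
module Submission where

open import Defs
open import Data.Nat using (ℕ; _≤_)
open import Data.Nat.Primality using (Prime; ¬prime[1])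
open import Data.Sum using (_⊎_; inj₁; inj₂)

import Data.Nat as ℕ
import Data.Nat.Properties as ℕ
import Data.Nat.Divisibility as ℕ
open import Data.Integer using (+_; -_; _-_) renaming (_+_ to _+ℤ_; _*_ to _*ℤ_)
import Data.Integer.Properties as ℤ
open import Data.Integer.Divisibility.Signed
  using (_∣_; divides; ∣-refl; ∣-trans; ∣-reflexive; ∣m⇒∣-m; ∣m∣n⇒∣m+n; ∣n⇒∣m*n; ∣m⇒∣m*n;
         ∣m+n∣n⇒∣m; ∣⇒∣ᵤ)
open import Data.Integer.Tactic.RingSolver using (solve-∀)
open import Data.Fin using (Fin; zero; suc; _↑ˡ_; _↑ʳ_; fromℕ<)
open import Data.Fin.Properties using (splitAt-↑ˡ; splitAt-↑ʳ)
open import Data.Vec.Functional using (_++_)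
open import Data.Vec.Functional.Properties using (lookup-++ˡ; lookup-++ʳ)
open import Data.Product using (Σ; _×_; _,_; proj₁; proj₂)
open import Function using (_∘_)
open import Level using (0ℓ)
open import Relation.Binary.Bundles using (Setoid)
open import Relation.Binary.PropositionalEquality
  using (_≡_; _≢_; _≗_; refl; sym; cong; subst; module ≡-Reasoning)
open import Relation.Nullary using (¬_)

module _ {p : ℕ} where

  -- `_≈_` unfolds to a Π-type, so Agda cannot infer its arguments from a
  -- goal; it can for this record, stated with signed divisibility.
  infix 4 _≋_
  record _≋_ (x y : ℤp p) : Set where
    constructor mk≋
    field levelwise : ∀ n → + (p ℕ.^ n) ∣ seq x n - seq y n
  open _≋_ public

  ≈⇒≋ : ∀ {x y} → x ≈ y → x ≋ y
  ≈⇒≋ x≈y = mk≋ λ n → let t , eq = x≈y n in divides t eq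

  ≋⇒≈ : ∀ {x y} → x ≋ y → x ≈ y
  ≋⇒≈ x≋y n = let divides t eq = levelwise x≋y n in t , eq

  ≗⇒≋ : ∀ {x y} → seq x ≗ seq y → x ≋ y
  ≗⇒≋ {x} {y} x≗y = mk≋ λ n → divides (+ 0) (begin
    seq x n - seq y n  ≡⟨ cong (_- seq y n) (x≗y n) ⟩
    seq y n - seq y n  ≡⟨ ℤ.+-inverseʳ (seq y n) ⟩
    + 0                ≡⟨ ℤ.*-zeroˡ (+ (p ℕ.^ n)) ⟨
    + 0 *ℤ + (p ℕ.^ n) ∎)
    where open ≡-Reasoning

  private
    neg-minus : ∀ a b → - (a - b) ≡ b - a
    neg-minus = solve-∀
    minus-telescope : ∀ a b c → (a - b) +ℤ (b - c) ≡ a - c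
    minus-telescope = solve-∀
    minus-interchange : ∀ a b c d → (a - c) +ℤ (b - d) ≡ (a +ℤ b) - (c +ℤ d)
    minus-interchange = solve-∀
    minus-product : ∀ a b c d → a *ℤ (b - d) +ℤ d *ℤ (a - c) ≡ a *ℤ b - c *ℤ d
    minus-product = solve-∀

  ≋-refl : ∀ {x} → x ≋ x
  ≋-refl = ≗⇒≋ λ _ → refl

  ≡⇒≋ : ∀ {x y} → x ≡ y → x ≋ y
  ≡⇒≋ refl = ≋-refl

  ≋-sym : ∀ {x y} → x ≋ y → y ≋ x
  ≋-sym {x} {y} (mk≋ d) = mk≋ λ n →
    subst (_ ∣_) (neg-minus (seq x n) (seq y n)) (∣m⇒∣-m (d n))

  ≋-trans : ∀ {x y z} → x ≋ y → y ≋ z → x ≋ z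
  ≋-trans {x} {y} {z} (mk≋ d) (mk≋ e) = mk≋ λ n →
    subst (_ ∣_) (minus-telescope (seq x n) (seq y n) (seq z n))
      (∣m∣n⇒∣m+n (d n) (e n))

  ℤp-setoid : Setoid 0ℓ 0ℓ
  ℤp-setoid = record
    { Carrier = ℤp p
    ; _≈_ = _≋_
    ; isEquivalence = record { refl = ≋-refl ; sym = ≋-sym ; trans = ≋-trans }
    }

  open import Relation.Binary.Reasoning.Setoid ℤp-setoid

  +p-cong : ∀ {x x′ y y′} → x ≋ x′ → y ≋ y′ → x +p y ≋ x′ +p y′
  +p-cong {x} {x′} {y} {y′} (mk≋ d) (mk≋ e) = mk≋ λ n →
    subst (_ ∣_) (minus-interchange (seq x n) (seq y n) (seq x′ n) (seq y′ n))
      (∣m∣n⇒∣m+n (d n) (e n))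

  +p-congˡ : ∀ x {y y′} → y ≋ y′ → x +p y ≋ x +p y′
  +p-congˡ x = +p-cong (≋-refl {x})

  +p-congʳ : ∀ y {x x′} → x ≋ x′ → x +p y ≋ x′ +p y
  +p-congʳ y x≋x′ = +p-cong x≋x′ (≋-refl {y})

  *p-cong : ∀ {x x′ y y′} → x ≋ x′ → y ≋ y′ → x *p y ≋ x′ *p y′
  *p-cong {x} {x′} {y} {y′} (mk≋ d) (mk≋ e) = mk≋ λ n →
    subst (_ ∣_) (minus-product (seq x n) (seq y n) (seq x′ n) (seq y′ n))
      (∣m∣n⇒∣m+n (∣n⇒∣m*n (seq x n) (e n)) (∣n⇒∣m*n (seq y′ n) (d n)))

  *p-congˡ : ∀ x {y y′} → y ≋ y′ → x *p y ≋ x *p y′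
  *p-congˡ x = *p-cong (≋-refl {x})

  +p-identityˡ : ∀ x → 0p +p x ≋ x
  +p-identityˡ x = ≗⇒≋ λ n → ℤ.+-identityˡ (seq x n)

  +p-identityʳ : ∀ x → x +p 0p ≋ x
  +p-identityʳ x = ≗⇒≋ λ n → ℤ.+-identityʳ (seq x n)

  +p-assoc : ∀ x y z → (x +p y) +p z ≋ x +p (y +p z)
  +p-assoc x y z = ≗⇒≋ λ n → ℤ.+-assoc (seq x n) (seq y n) (seq z n)

  [x-y]+y≋x : ∀ x y → (x +p -p y) +p y ≋ x
  [x-y]+y≋x x y = ≗⇒≋ λ n → cancel (seq x n) (seq y n)
    where
    cancel : ∀ a b → (a - b) +ℤ b ≡ a
    cancel = solve-∀

  y+[x-y]≋x : ∀ x y → y +p (x +p -p y) ≋ x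
  y+[x-y]≋x x y = ≗⇒≋ λ n → cancel (seq x n) (seq y n)
    where
    cancel : ∀ a b → b +ℤ (a - b) ≡ a
    cancel = solve-∀

  *p-zeroˡ : ∀ x → 0p *p x ≋ 0p
  *p-zeroˡ x = ≗⇒≋ λ n → ℤ.*-zeroˡ (seq x n)

  *p-zeroʳ : ∀ x → x *p 0p ≋ 0p
  *p-zeroʳ x = ≗⇒≋ λ n → ℤ.*-zeroʳ (seq x n)

  *p-distribˡ-+p : ∀ x y z → x *p (y +p z) ≋ x *p y +p x *p z
  *p-distribˡ-+p x y z = ≗⇒≋ λ n → ℤ.*-distribˡ-+ (seq x n) (seq y n) (seq z n)

  x*[y*z]≋y*[x*z] : ∀ x y z → x *p (y *p z) ≋ y *p (x *p z)
  x*[y*z]≋y*[x*z] x y z = ≗⇒≋ λ n → swap (seq x n) (seq y n) (seq z n)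
    where
    swap : ∀ a b c → a *ℤ (b *ℤ c) ≡ b *ℤ (a *ℤ c)
    swap = solve-∀

  sump-cong : ∀ n {f g : Fin n → ℤp p} → (∀ i → f i ≋ g i) → sump n f ≋ sump n g
  sump-cong ℕ.zero    f≋g = ≋-refl
  sump-cong (ℕ.suc n) f≋g = +p-cong (f≋g zero) (sump-cong n (f≋g ∘ suc))

  sump-zero : ∀ n {f : Fin n → ℤp p} → (∀ i → f i ≋ 0p) → sump n f ≋ 0p
  sump-zero ℕ.zero    f≋0 = ≋-refl
  sump-zero (ℕ.suc n) {f} f≋0 = begin
    f zero +p sump n (f ∘ suc)  ≈⟨ +p-cong (f≋0 zero) (sump-zero n (f≋0 ∘ suc)) ⟩
    0p +p 0p                    ≈⟨ +p-identityˡ 0p ⟩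
    0p                          ∎

  sump-*p : ∀ n c (f : Fin n → ℤp p) → sump n (λ i → c *p f i) ≋ c *p sump n f
  sump-*p ℕ.zero    c f = ≋-sym (*p-zeroʳ c)
  sump-*p (ℕ.suc n) c f = begin
    c *p f zero +p sump n (λ i → c *p f (suc i))
      ≈⟨ +p-congˡ (c *p f zero) (sump-*p n c (f ∘ suc)) ⟩
    c *p f zero +p c *p sump n (f ∘ suc)
      ≈⟨ *p-distribˡ-+p c (f zero) (sump n (f ∘ suc)) ⟨
    c *p (f zero +p sump n (f ∘ suc))
      ∎

  sump-split : ∀ m k (f : Fin (m ℕ.+ k) → ℤp p) →
    sump (m ℕ.+ k) f ≋ sump m (f ∘ (_↑ˡ k)) +p sump k (f ∘ (m ↑ʳ_))
  sump-split ℕ.zero    k f = ≋-sym (+p-identityˡ (sump k f))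
  sump-split (ℕ.suc m) k f = begin
    f zero +p sump (m ℕ.+ k) (f ∘ suc)  ≈⟨ +p-congˡ (f zero) (sump-split m k (f ∘ suc)) ⟩
    f zero +p (left +p right)           ≈⟨ +p-assoc (f zero) left right ⟨
    (f zero +p left) +p right           ∎
    where
    left right : ℤp p
    left  = sump m (f ∘ suc ∘ (_↑ˡ k))
    right = sump k (f ∘ suc ∘ (m ↑ʳ_))

  sump-split-zeroʳ : ∀ m k (f : Fin (m ℕ.+ k) → ℤp p) →
    (∀ b → f (m ↑ʳ b) ≋ 0p) → sump (m ℕ.+ k) f ≋ sump m (f ∘ (_↑ˡ k))
  sump-split-zeroʳ m k f f≋0 = begin
    sump (m ℕ.+ k) f                   ≈⟨ sump-split m k f ⟩
    left +p sump k (f ∘ (m ↑ʳ_))       ≈⟨ +p-congˡ left (sump-zero k f≋0) ⟩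
    left +p 0p                         ≈⟨ +p-identityʳ left ⟩
    left                               ∎
    where
    left : ℤp p
    left = sump m (f ∘ (_↑ˡ k))

  sump-split-zeroˡ : ∀ m k (f : Fin (m ℕ.+ k) → ℤp p) →
    (∀ a → f (a ↑ˡ k) ≋ 0p) → sump (m ℕ.+ k) f ≋ sump k (f ∘ (m ↑ʳ_))
  sump-split-zeroˡ m k f f≋0 = begin
    sump (m ℕ.+ k) f                   ≈⟨ sump-split m k f ⟩
    sump m (f ∘ (_↑ˡ k)) +p right      ≈⟨ +p-congʳ right (sump-zero m f≋0) ⟩
    0p +p right                        ≈⟨ +p-identityˡ right ⟩
    right                              ∎
    where
    right : ℤp p
    right = sump k (f ∘ (m ↑ʳ_))

  ·-cong : ∀ {n′ n} (A : Fin n′ → Fin n → ℤp p) {x y : Vecp p n} →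
    (∀ j → x j ≋ y j) → ∀ i → (A · x) i ≋ (A · y) i
  ·-cong {n = n} A x≋y i = sump-cong n λ j → *p-congˡ (A i j) (x≋y j)

  ·-scale : ∀ {n′ n} (A : Fin n′ → Fin n → ℤp p) c (w : Vecp p n) →
    ∀ i → (A · (λ j → c *p w j)) i ≋ c *p (A · w) i
  ·-scale {n = n} A c w i = begin
    sump n (λ j → A i j *p (c *p w j))  ≈⟨ sump-cong n (λ j → x*[y*z]≋y*[x*z] (A i j) c (w j)) ⟩
    sump n (λ j → c *p (A i j *p w j))  ≈⟨ sump-*p n c (λ j → A i j *p w j) ⟩
    c *p (A · w) i                      ∎

  Q-cong : ∀ (L : Lattice p) {x y : Vecp p (rank L)} → (∀ i → x i ≋ y i) → Q L x ≋ Q L y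
  Q-cong L x≋y = sump-cong (rank L) λ i → sump-cong (rank L) λ j →
    *p-congˡ (coeff L i j) (*p-cong (x≋y i) (x≋y j))

  PrimitiveRepresentation : Lattice p → ℤp p → Set
  PrimitiveRepresentation L α = Σ (Vecp p (rank L)) λ v → Primitive L v × Q L v ≈ α

  primitiveRepresentation-transport : ∀ {L N α} → Isometry L N →
    PrimitiveRepresentation N α → PrimitiveRepresentation L α
  primitiveRepresentation-transport {L} {N} {α} (A , B , _ , AB , QA) (v , v-prim , Qv≈α) =
    B · v , Bv-prim , ≋⇒≈ QBv≋α
    where
    ABv≋v : ∀ i → (A · (B · v)) i ≋ v i
    ABv≋v i = ≈⇒≋ (AB v i)

    QBv≋α : Q L (B · v) ≋ α
    QBv≋α = begin
      Q L (B · v)        ≈⟨ ≈⇒≋ (QA (B · v)) ⟨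
      Q N (A · (B · v))  ≈⟨ Q-cong N ABv≋v ⟩
      Q N v              ≈⟨ ≈⇒≋ Qv≈α ⟩
      α                  ∎

    Bv-prim : Primitive L (B · v)
    Bv-prim (w , Bv≈pw) = v-prim (A · w , λ i → ≋⇒≈ (begin
      v i                        ≈⟨ ABv≋v i ⟨
      (A · (B · v)) i            ≈⟨ ·-cong A Bv≋pw i ⟩
      (A · (λ j → pp *p w j)) i  ≈⟨ ·-scale A pp w i ⟩
      pp *p (A · w) i            ∎))
      where
      Bv≋pw : ∀ j → (B · v) j ≋ pp *p w j
      Bv≋pw j = ≈⇒≋ (Bv≈pw j)

  1p≉pp*p : p ≢ 1 → ∀ u → ¬ (1p ≈ pp *p u)
  1p≉pp*p p≢1 u 1≈pu = p≢1 (ℕ.∣1⇒≡1 (∣⇒∣ᵤ p∣1))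
    where
    p∣1-pu : + p ∣ + 1 - + p *ℤ seq u 1
    p∣1-pu = ∣-trans (∣-reflexive (cong +_ (sym (ℕ.*-identityʳ p))))
                     (levelwise (≈⇒≋ {1p} {pp *p u} 1≈pu) 1)
    p∣1 : + p ∣ + 1
    p∣1 = ∣m+n∣n⇒∣m p∣1-pu (∣m⇒∣-m (∣m⇒∣m*n (seq u 1) ∣-refl))

  const-1p-primitive : p ≢ 1 → (L : Lattice p) → Fin (rank L) → Primitive L (λ _ → 1p)
  const-1p-primitive p≢1 L i (w , 1≈pw) = 1p≉pp*p p≢1 (w i) (1≈pw i)

  module _ (M K : Lattice p) (x : Vecp p (rank M)) (y : Vecp p (rank K)) where
    private
      m k : ℕ
      m = rank M
      k = rank K

      term : Fin (m ℕ.+ k) → Fin (m ℕ.+ k) → ℤp p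
      term i j = coeff (M ⊥ K) i j *p ((x ++ y) i *p (x ++ y) j)

      term-↑ˡ-↑ˡ : ∀ a b → term (a ↑ˡ k) (b ↑ˡ k) ≡ coeff M a b *p (x a *p x b)
      term-↑ˡ-↑ˡ a b rewrite splitAt-↑ˡ m a k | splitAt-↑ˡ m b k = refl

      term-↑ˡ-↑ʳ : ∀ a b → term (a ↑ˡ k) (m ↑ʳ b) ≋ 0p
      term-↑ˡ-↑ʳ a b rewrite splitAt-↑ˡ m a k | splitAt-↑ʳ m k b = *p-zeroˡ (x a *p y b)

      term-↑ʳ-↑ˡ : ∀ a b → term (m ↑ʳ a) (b ↑ˡ k) ≋ 0p
      term-↑ʳ-↑ˡ a b rewrite splitAt-↑ʳ m k a | splitAt-↑ˡ m b k = *p-zeroˡ (y a *p x b)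

      term-↑ʳ-↑ʳ : ∀ a b → term (m ↑ʳ a) (m ↑ʳ b) ≡ coeff K a b *p (y a *p y b)
      term-↑ʳ-↑ʳ a b rewrite splitAt-↑ʳ m k a | splitAt-↑ʳ m k b = refl

      row-↑ˡ : ∀ a → sump (m ℕ.+ k) (term (a ↑ˡ k)) ≋ sump m λ b → coeff M a b *p (x a *p x b)
      row-↑ˡ a = ≋-trans (sump-split-zeroʳ m k (term (a ↑ˡ k)) (term-↑ˡ-↑ʳ a))
                         (sump-cong m (≡⇒≋ ∘ term-↑ˡ-↑ˡ a))

      row-↑ʳ : ∀ a → sump (m ℕ.+ k) (term (m ↑ʳ a)) ≋ sump k λ b → coeff K a b *p (y a *p y b)
      row-↑ʳ a = ≋-trans (sump-split-zeroˡ m k (term (m ↑ʳ a)) (term-↑ʳ-↑ˡ a))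
                         (sump-cong k (≡⇒≋ ∘ term-↑ʳ-↑ʳ a))

    Q-⊥ : Q (M ⊥ K) (x ++ y) ≋ Q M x +p Q K y
    Q-⊥ = ≋-trans (sump-split m k (λ i → sump (m ℕ.+ k) (term i)))
                  (+p-cong (sump-cong m row-↑ˡ) (sump-cong k row-↑ʳ))

    ++-primitiveˡ : Primitive M x → Primitive (M ⊥ K) (x ++ y)
    ++-primitiveˡ x-prim (w , x++y≈pw) = x-prim (w ∘ (_↑ˡ k) , λ a →
      subst (_≈ pp *p w (a ↑ˡ k)) (lookup-++ˡ x y a) (x++y≈pw (a ↑ˡ k)))

    ++-primitiveʳ : Primitive K y → Primitive (M ⊥ K) (x ++ y)
    ++-primitiveʳ y-prim (w , x++y≈pw) = y-prim (w ∘ (m ↑ʳ_) , λ b →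
      subst (_≈ pp *p w (m ↑ʳ b)) (lookup-++ʳ x y b) (x++y≈pw (m ↑ʳ b)))

  ⊥-primitiveRepresentationˡ : ∀ (M K : Lattice p) → Universal M →
    ∀ y → Primitive K y → ∀ α → PrimitiveRepresentation (M ⊥ K) α
  ⊥-primitiveRepresentationˡ M K universal y y-prim α =
    x ++ y , ++-primitiveʳ M K x y y-prim , ≋⇒≈ Q[x++y]≋α
    where
    β : ℤp p
    β = Q K y
    x : Vecp p (rank M)
    x = proj₁ (universal (α +p -p β))
    Qx≋α-β : Q M x ≋ α +p -p β
    Qx≋α-β = ≈⇒≋ (proj₂ (universal (α +p -p β)))
    Q[x++y]≋α : Q (M ⊥ K) (x ++ y) ≋ α
    Q[x++y]≋α = begin
      Q (M ⊥ K) (x ++ y)  ≈⟨ Q-⊥ M K x y ⟩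
      Q M x +p β          ≈⟨ +p-congʳ β Qx≋α-β ⟩
      (α +p -p β) +p β    ≈⟨ [x-y]+y≋x α β ⟩
      α                   ∎

  ⊥-primitiveRepresentationʳ : ∀ (M K : Lattice p) → Universal K →
    ∀ x → Primitive M x → ∀ α → PrimitiveRepresentation (M ⊥ K) α
  ⊥-primitiveRepresentationʳ M K universal x x-prim α =
    x ++ y , ++-primitiveˡ M K x y x-prim , ≋⇒≈ Q[x++y]≋α
    where
    β : ℤp p
    β = Q M x
    y : Vecp p (rank K)
    y = proj₁ (universal (α +p -p β))
    Qy≋α-β : Q K y ≋ α +p -p β
    Qy≋α-β = ≈⇒≋ (proj₂ (universal (α +p -p β)))
    Q[x++y]≋α : Q (M ⊥ K) (x ++ y) ≋ α
    Q[x++y]≋α = begin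
      Q (M ⊥ K) (x ++ y)  ≈⟨ Q-⊥ M K x y ⟩
      β +p Q K y          ≈⟨ +p-congˡ β Qy≋α-β ⟩
      β +p (α +p -p β)    ≈⟨ y+[x-y]≋x α β ⟩
      α                   ∎

lemma3p6 : (p : ℕ) → Prime p → (L M K : Lattice p) →
    1 ≤ rank M → 1 ≤ rank K → Isometry L (M ⊥ K) →
    Universal M ⊎ Universal K → PrimitivelyUniversal L
lemma3p6 p p-prime L M K 1≤rankM 1≤rankK iso universal α _ =
  primitiveRepresentation-transport {L = L} {N = M ⊥ K} {α} iso (represent universal α)
  where
  p≢1 : p ≢ 1
  p≢1 refl = ¬prime[1] p-prime
  represent : Universal M ⊎ Universal K → ∀ α → PrimitiveRepresentation (M ⊥ K) α
  represent (inj₁ universalM) =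
    ⊥-primitiveRepresentationˡ M K universalM (λ _ → 1p)
      (const-1p-primitive p≢1 K (fromℕ< 1≤rankK))
  represent (inj₂ universalK) =
    ⊥-primitiveRepresentationʳ M K universalK (λ _ → 1p)
      (const-1p-primitive p≢1 M (fromℕ< 1≤rankM))
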